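{- Let $h\in\mathbb{N}$ and let $p$ be a prime. If $p\neq 3$ then $\mathcal{M}_{3,3}(p^{h})=\mathbb{Z}/p^{h}\mathbb{Z}$. For $p=3$ one has $\mathcal{M}_{3,3}(3)=\mathbb{Z}/3\mathbb{Z}$, and for $h\geq 2$, \[\mathcal{M}_{3,3}(3^{h})=\{x\in\mathbb{Z}/3^{h}\mathbb{Z}:\ x\not\equiv 4\pmod 9,\ x\not\equiv 5\pmod 9\}.\]
   Context: $\mathcal{M}_{3,3}(p^{h})=\{x_{1}^{3}+x_{2}^{3}+x_{3}^{3}:\ (x_1,x_2,x_3)\in(\mathbb{Z}/p^{h}\mathbb{Z})^{3},\ (x_{1},p)=1\}\subseteq\mathbb{Z}/p^{h}\mathbb{Z}$. -}

module Defs where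

open import Data.Nat using (ℕ; _+_; _*_; _^_; NonZero)
open import Data.Nat.DivMod using (_%_)
open import Data.Nat.Coprimality using (Coprime)
open import Data.Fin using (Fin; toℕ)
open import Data.Product using (Σ; _×_)
open import Relation.Binary.PropositionalEquality using (_≡_)

-- Z/nZ is modelled as Fin n (canonical representatives 0..n-1);
-- arithmetic is done on representatives in ℕ and reduced mod n.

cube : ℕ → ℕ
cube x = x * x * x

InM33 : (p n : ℕ) .{{_ : NonZero n}} → Fin n → Set
InM33 p n y =
  Σ (Fin n) λ x₁ → Σ (Fin n) λ x₂ → Σ (Fin n) λ x₃ →
    Coprime (toℕ x₁) p ×
    ((cube (toℕ x₁) + cube (toℕ x₂) + cube (toℕ x₃)) % n ≡ toℕ y)

module Submission where

-- For p ≠ 3 the derivative 3x² of x ↦ x³ is a unit at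
-- every p-unit x, so by Hensel's lemma a representation y ≡ x₁³ + x₂³ + x₃³ (mod p) with
-- p ∤ x₁ lifts to every p^h. Modulo p it exists by a table for p = 2 and, for p ≥ 5, by
-- Ryley's identity z·D³ = A³ + B³ + C³ with D = 9z² + 81z + 729, applied to z or to −z
-- (D(z) and D(−z) have no common prime factor besides 2 and 3). For p = 3 the derivative
-- vanishes mod 3, but x₁² ≡ 1 (mod 3), so shifting x₁ by a multiple of 3^(h−1) still lifts
-- from 3^h to 3^(h+1) once h ≥ 2, starting from a table mod 9. Conversely, x³ mod 9 only
-- depends on x mod 3 and is 0 or ±1, and ±1 when 3 ∤ x; a sum ±1 + {0, ±1} + {0, ±1} is
-- never 4 or 5 mod 9.

open import Defs
open import Data.Nat using (ℕ; _^_; _≤_; _%_; NonZero)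
open import Data.Nat.Primality using (Prime)
open import Data.Fin using (Fin; toℕ)
open import Data.Product using (_×_)
open import Function.Bundles using (_⇔_)
open import Relation.Nullary using (¬_)
open import Relation.Binary.PropositionalEquality using (_≡_)

open import Data.Fin as Fin using (fromℕ<)
open import Data.Fin.Patterns
open import Data.Fin.Properties using (toℕ-fromℕ<; toℕ<n; all?)
open import Data.Integer as ℤ using (ℤ; +_; 0ℤ; 1ℤ; -1ℤ; _+_; _*_; -_; _-_; ∣_∣)
import Data.Integer.Properties as ℤ
open import Data.Integer.Divisibility.Signed
open import Data.Integer.DivMod using (_%ℕ_; _/ℕ_; n%ℕd<d; a≡a%ℕn+[a/ℕn]*n)
open import Data.Integer.Tactic.RingSolver using (solve)
open import Data.List using (_∷_; [])
open import Data.Nat as ℕ using (zero; suc)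
import Data.Nat.Divisibility as ℕ
import Data.Nat.DivMod as ℕ
import Data.Nat.Properties as ℕ
open import Data.Nat.Coprimality using (Coprime; coprime-Bézout; prime⇒coprime)
open import Data.Nat.GCD using (module Bézout)
open import Data.Nat.Primality using (prime?; prime[2]; prime⇒irreducible; prime⇒nonZero; euclidsLemma; ¬prime[1])
open import Data.Product using (∃-syntax; _,_)
open import Data.Sum using (_⊎_; inj₁; inj₂; [_,_]′)
open import Function.Bundles using (mk⇔)
open import Level using (0ℓ)
open import Relation.Binary.Bundles using (Setoid)
open import Relation.Binary.PropositionalEquality using (refl; sym; trans; cong; cong₂; subst; module ≡-Reasoning)
import Relation.Binary.Reasoning.Setoid as SetoidReasoning
open import Relation.Nullary using (yes; no; contradiction)
open import Relation.Nullary.Decidable using (True; toWitness; ¬?; _⊎-dec_; _×-dec_)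

private variable
  p q : ℕ
  k m x x′ y y′ z : ℤ

-- The ring solver does not unfold _³, so identities between cubes are proved on the
-- expanded products.
infix 9 _³
_³ : ℤ → ℤ
x ³ = x * x * x

-- A record rather than a synonym for m ∣ x - y, so that x, y and m are inferable.
infix 4 _≡_mod_
record _≡_mod_ (x y m : ℤ) : Set where
  constructor ∣-diff
  field m∣x-y : m ∣ x - y
open _≡_mod_ public

≡⇒≡-mod : x ≡ y → x ≡ y mod m
≡⇒≡-mod {x} refl = ∣-diff (divides 0ℤ (ℤ.+-inverseʳ x))

≡-mod-sym : x ≡ y mod m → y ≡ x mod m
≡-mod-sym {x} {y} {m} (∣-diff m∣x-y) = ∣-diff (subst (m ∣_) negate (∣m⇒∣-m m∣x-y))
  where
  negate : - (x - y) ≡ y - x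
  negate = solve (x ∷ y ∷ [])

≡-mod-trans : x ≡ y mod m → y ≡ z mod m → x ≡ z mod m
≡-mod-trans {x} {y} {m} {z} (∣-diff m∣x-y) (∣-diff m∣y-z) =
  ∣-diff (subst (m ∣_) telescope (∣m∣n⇒∣m+n m∣x-y m∣y-z))
  where
  telescope : (x - y) + (y - z) ≡ x - z
  telescope = solve (x ∷ y ∷ z ∷ [])

+-cong-mod : x ≡ x′ mod m → y ≡ y′ mod m → x + y ≡ x′ + y′ mod m
+-cong-mod {x} {x′} {m} {y} {y′} (∣-diff m∣x-x′) (∣-diff m∣y-y′) =
  ∣-diff (subst (m ∣_) regroup (∣m∣n⇒∣m+n m∣x-x′ m∣y-y′))
  where
  regroup : (x - x′) + (y - y′) ≡ (x + y) - (x′ + y′)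
  regroup = solve (x ∷ x′ ∷ y ∷ y′ ∷ [])

neg-cong-mod : x ≡ x′ mod m → - x ≡ - x′ mod m
neg-cong-mod {x} {x′} {m} (∣-diff m∣x-x′) = ∣-diff (subst (m ∣_) negate (∣m⇒∣-m m∣x-x′))
  where
  negate : - (x - x′) ≡ - x - - x′
  negate = solve (x ∷ x′ ∷ [])

*-cong-mod : x ≡ x′ mod m → y ≡ y′ mod m → x * y ≡ x′ * y′ mod m
*-cong-mod {x} {x′} {m} {y} {y′} (∣-diff m∣x-x′) (∣-diff m∣y-y′) =
  ∣-diff (subst (m ∣_) regroup (∣m∣n⇒∣m+n (∣m⇒∣m*n y m∣x-x′) (∣n⇒∣m*n x′ m∣y-y′)))
  where
  regroup : (x - x′) * y + x′ * (y - y′) ≡ x * y - x′ * y′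
  regroup = solve (x ∷ x′ ∷ y ∷ y′ ∷ [])

³-cong-mod : x ≡ x′ mod m → x ³ ≡ x′ ³ mod m
³-cong-mod x≡x′ = *-cong-mod (*-cong-mod x≡x′ x≡x′) x≡x′

≡-mod-setoid : ℤ → Setoid 0ℓ 0ℓ
≡-mod-setoid m = record
  { Carrier       = ℤ
  ; _≈_           = λ x y → x ≡ y mod m
  ; isEquivalence = record { refl = ≡⇒≡-mod refl ; sym = ≡-mod-sym ; trans = ≡-mod-trans }
  }

module ≡-mod-Reasoning (m : ℤ) = SetoidReasoning (≡-mod-setoid m)

∣⇒≡0-mod : m ∣ x → x ≡ 0ℤ mod m
∣⇒≡0-mod {m} {x} m∣x = ∣-diff (subst (m ∣_) (sym (ℤ.+-identityʳ x)) m∣x)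

≡-mod-∣ : x ≡ y mod m → k ∣ m → k ∣ y → k ∣ x
≡-mod-∣ {x} {y} {m} {k} (∣-diff m∣x-y) k∣m k∣y =
  subst (k ∣_) cancel (∣m∣n⇒∣m+n (∣-trans k∣m m∣x-y) k∣y)
  where
  cancel : (x - y) + y ≡ x
  cancel = solve (x ∷ y ∷ [])

≡-mod-weaken : k ∣ m → x ≡ y mod m → x ≡ y mod k
≡-mod-weaken k∣m (∣-diff m∣x-y) = ∣-diff (∣-trans k∣m m∣x-y)

≡+*⇒≡-mod : ∀ k → x ≡ y + k * m → x ≡ y mod m
≡+*⇒≡-mod {y = y} {m} k refl = ∣-diff (divides k (solve (y ∷ k ∷ m ∷ [])))

%ℕ-≡-mod : ∀ x n .{{_ : ℕ.NonZero n}} → x ≡ + (x %ℕ n) mod + n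
%ℕ-≡-mod x n = ≡+*⇒≡-mod (x /ℕ n) (a≡a%ℕn+[a/ℕn]*n x n)

residue : ∀ m .{{_ : ℕ.NonZero m}} → ℤ → Fin m
residue m z = fromℕ< (n%ℕd<d z m)

≡-mod-residue : ∀ m .{{_ : ℕ.NonZero m}} z → z ≡ + toℕ (residue m z) mod + m
≡-mod-residue m z = subst (λ r → z ≡ + r mod + m) (sym (toℕ-fromℕ< (n%ℕd<d z m))) (%ℕ-≡-mod z m)

residue-unique : ∀ {n r s} → r ℕ.< n → s ℕ.< n → + r ≡ + s mod + n → r ≡ s
residue-unique {n} {r} {s} r<n s<n (∣-diff n∣r-s) =
  ℤ.+-injective (ℤ.i-j≡0⇒i≡j (+ r) (+ s) (ℤ.∣i∣≡0⇒i≡0 ∣r-s∣≡0))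
  where
  ∣r-s∣<n : ∣ + r - + s ∣ ℕ.< n
  ∣r-s∣<n = subst (ℕ._< n) (cong ∣_∣ (sym (ℤ.m-n≡m⊖n r s)))
                  (ℕ.≤-<-trans (ℤ.∣m⊝n∣≤m⊔n r s) (ℕ.⊔-lub r<n s<n))
  ∣r-s∣≡0 : ∣ + r - + s ∣ ≡ 0
  ∣r-s∣≡0 with ∣ + r - + s ∣ | ∣⇒∣ᵤ n∣r-s | ∣r-s∣<n
  ... | zero  | _   | _   = refl
  ... | suc d | n∣d | d<n = contradiction (ℕ.∣⇒≤ n∣d) (ℕ.<⇒≱ d<n)

%-≡-mod : ∀ a b n .{{_ : ℕ.NonZero n}} → + a ≡ + b mod + n → a % n ≡ b % n
%-≡-mod a b n a≡b = residue-unique (ℕ.m%n<n a n) (ℕ.m%n<n b n)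
  (≡-mod-trans (≡-mod-sym (%ℕ-≡-mod (+ a) n)) (≡-mod-trans a≡b (%ℕ-≡-mod (+ b) n)))

³-cong-mod-3⇒9 : x ≡ x′ mod + 3 → x ³ ≡ x′ ³ mod + 9
³-cong-mod-3⇒9 {x} {x′} (∣-diff (divides k x-x′≡3k)) =
  ∣-diff (divides (x′ * x′ * k + + 3 * x′ * k * k + + 3 * k * k * k) (begin
    x * x * x - x′ * x′ * x′
      ≡⟨ cong (λ w → w * w * w - x′ * x′ * x′) x≡x′+3k ⟩
    (x′ + k * + 3) * (x′ + k * + 3) * (x′ + k * + 3) - x′ * x′ * x′
      ≡⟨ solve (x′ ∷ k ∷ []) ⟩
    (x′ * x′ * k + + 3 * x′ * k * k + + 3 * k * k * k) * + 9
      ∎))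
  where
  open ≡-Reasoning
  x≡x′+3k : x ≡ x′ + k * + 3
  x≡x′+3k = begin
    x               ≡⟨ solve (x ∷ x′ ∷ []) ⟩
    x′ + (x - x′)   ≡⟨ cong (λ d → x′ + d) x-x′≡3k ⟩
    x′ + k * + 3    ∎

prime[3] : Prime 3
prime[3] = toWitness {a? = prime? 3} _

prime≢1 : Prime p → ¬ p ≡ 1
prime≢1 pr refl = ¬prime[1] pr

prime∣prime⇒≡ : Prime p → Prime q → p ℕ.∣ q → p ≡ q
prime∣prime⇒≡ pr qr p∣q with prime⇒irreducible qr p∣q
... | inj₁ p≡1 = contradiction p≡1 (prime≢1 pr)
... | inj₂ p≡q = p≡q

prime∣prime^⇒≡ : Prime p → Prime q → ∀ n → p ℕ.∣ q ^ n → p ≡ q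
prime∣prime^⇒≡ pr qr zero    p∣1 = contradiction (ℕ.∣1⇒≡1 p∣1) (prime≢1 pr)
prime∣prime^⇒≡ pr qr (suc n) p∣qqⁿ with euclidsLemma _ _ pr p∣qqⁿ
... | inj₁ p∣q  = prime∣prime⇒≡ pr qr p∣q
... | inj₂ p∣qⁿ = prime∣prime^⇒≡ pr qr n p∣qⁿ

prime∣13122 : Prime p → + p ∣ + 13122 → p ≡ 2 ⊎ p ≡ 3
prime∣13122 pr p∣13122 with euclidsLemma 2 (3 ^ 8) pr (∣⇒∣ᵤ p∣13122)
... | inj₁ p∣2   = inj₁ (prime∣prime⇒≡ pr prime[2] p∣2)
... | inj₂ p∣3⁸  = inj₂ (prime∣prime^⇒≡ pr prime[3] 8 p∣3⁸)

prime∣*⇒∣⊎∣ : Prime p → + p ∣ x * y → (+ p ∣ x) ⊎ (+ p ∣ y)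
prime∣*⇒∣⊎∣ {p} {x} {y} pr p∣xy
  with euclidsLemma ∣ x ∣ ∣ y ∣ pr (subst (p ℕ.∣_) (ℤ.abs-* x y) (∣⇒∣ᵤ p∣xy))
... | inj₁ p∣x = inj₁ (∣ᵤ⇒∣ p∣x)
... | inj₂ p∣y = inj₂ (∣ᵤ⇒∣ p∣y)

prime∤* : Prime p → ¬ + p ∣ x → ¬ + p ∣ y → ¬ + p ∣ x * y
prime∤* pr p∤x p∤y p∣xy with prime∣*⇒∣⊎∣ pr p∣xy
... | inj₁ p∣x = p∤x p∣x
... | inj₂ p∣y = p∤y p∣y

prime∤1 : Prime p → ¬ + p ∣ 1ℤ
prime∤1 pr p∣1 = prime≢1 pr (ℕ.∣1⇒≡1 (∣⇒∣ᵤ p∣1))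

prime≢3⇒∤3 : Prime p → ¬ p ≡ 3 → ¬ + p ∣ + 3
prime≢3⇒∤3 pr p≢3 p∣3 = p≢3 (prime∣prime⇒≡ pr prime[3] (∣⇒∣ᵤ p∣3))

prime∤⇒coprime : Prime p → ∀ {n} → ¬ p ℕ.∣ n → Coprime n p
prime∤⇒coprime pr p∤n (i∣n , i∣p) with prime⇒irreducible pr i∣p
... | inj₁ i≡1    = i≡1
... | inj₂ refl   = contradiction i∣n p∤n

pos-Bézout : ∀ a b m n → 1 ℕ.+ a ℕ.* m ≡ b ℕ.* n → 1ℤ + + a * + m ≡ + b * + n
pos-Bézout a b m n eq =
  trans (cong (λ n → 1ℤ + n) (sym (ℤ.pos-* a m))) (trans (cong +_ eq) (ℤ.pos-* b n))

unit-residue-inverse : Prime p → ∀ r → suc r ℕ.< p → ∃[ u ] u * + suc r ≡ 1ℤ mod + p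
unit-residue-inverse {p} pr r r<p with coprime-Bézout (prime⇒coprime pr r<p)
... | Bézout.+- a b eq =
  - + b , ∣-diff (divides (- + a) (negated (+ b) (+ suc r) (+ a) (+ p) (pos-Bézout b a (suc r) p eq)))
  where
  negated : ∀ B R A P → 1ℤ + B * R ≡ A * P → - B * R - 1ℤ ≡ - A * P
  negated B R A P e = begin
    - B * R - 1ℤ     ≡⟨ solve (B ∷ R ∷ []) ⟩
    - (1ℤ + B * R)   ≡⟨ cong -_ e ⟩
    - (A * P)        ≡⟨ ℤ.neg-distribˡ-* A P ⟩
    - A * P          ∎
    where open ≡-Reasoning
... | Bézout.-+ a b eq =
  + b , ∣-diff (divides (+ a) (shifted (+ b) (+ suc r) (+ a) (+ p) (pos-Bézout a b p (suc r) eq)))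
  where
  shifted : ∀ B R A P → 1ℤ + A * P ≡ B * R → B * R - 1ℤ ≡ A * P
  shifted B R A P e = begin
    B * R - 1ℤ          ≡⟨ cong (_- 1ℤ) e ⟨
    1ℤ + A * P - 1ℤ     ≡⟨ solve (A ∷ P ∷ []) ⟩
    A * P               ∎
    where open ≡-Reasoning

mod-inverse : Prime p → ¬ + p ∣ x → ∃[ u ] u * x ≡ 1ℤ mod + p
mod-inverse {p} {x} pr p∤x with x %ℕ p | %ℕ-≡-mod x p | n%ℕd<d x p
  where instance _ = prime⇒nonZero pr
... | zero  | x≡0 | _   = contradiction (subst (+ p ∣_) (ℤ.+-identityʳ x) (m∣x-y x≡0)) p∤x
... | suc r | x≡r | r<p with unit-residue-inverse pr r r<p
...   | u , ur≡1 = u , ≡-mod-trans (*-cong-mod (≡⇒≡-mod {u} refl) x≡r) ur≡1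

record InM33ℤ (p : ℕ) (m y : ℤ) : Set where
  constructor cubes
  field
    x₁ x₂ x₃ : ℤ
    x₁-unit  : ¬ + p ∣ x₁
    sum≡y    : x₁ ³ + x₂ ³ + x₃ ³ ≡ y mod m

InM33ℤ-resp : y ≡ y′ mod m → InM33ℤ p m y → InM33ℤ p m y′
InM33ℤ-resp y≡y′ (cubes a b c a-unit sum≡y) = cubes a b c a-unit (≡-mod-trans sum≡y y≡y′)

InM33ℤ-residues : ∀ m .{{_ : ℕ.NonZero m}} →
  ((r : Fin m) → InM33ℤ p (+ m) (+ toℕ r)) → ∀ z → InM33ℤ p (+ m) z
InM33ℤ-residues m residues z = InM33ℤ-resp (≡-mod-sym (≡-mod-residue m z)) (residues (residue m z))

InM33ℤ-by-computation : ∀ {p m y} x₁ x₂ x₃ →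
  {True (¬? (+ p ∣? x₁))} → {True (m ∣? x₁ ³ + x₂ ³ + x₃ ³ - y)} → InM33ℤ p m y
InM33ℤ-by-computation x₁ x₂ x₃ {x₁-unit} {sum≡y} =
  cubes x₁ x₂ x₃ (toWitness x₁-unit) (∣-diff (toWitness sum≡y))

InM33ℤ-mod-2 : (r : Fin 2) → InM33ℤ 2 (+ 2) (+ toℕ r)
InM33ℤ-mod-2 0F = InM33ℤ-by-computation 1ℤ 1ℤ 0ℤ
InM33ℤ-mod-2 1F = InM33ℤ-by-computation 1ℤ 0ℤ 0ℤ

InM33ℤ-mod-3 : (r : Fin 3) → InM33ℤ 3 (+ 3) (+ toℕ r)
InM33ℤ-mod-3 0F = InM33ℤ-by-computation 1ℤ -1ℤ 0ℤ
InM33ℤ-mod-3 1F = InM33ℤ-by-computation 1ℤ 0ℤ 0ℤ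
InM33ℤ-mod-3 2F = InM33ℤ-by-computation 1ℤ 1ℤ 0ℤ

InM33ℤ-mod-9 : (r : Fin 9) → ¬ toℕ r ≡ 4 → ¬ toℕ r ≡ 5 → InM33ℤ 3 (+ 9) (+ toℕ r)
InM33ℤ-mod-9 0F _ _ = InM33ℤ-by-computation 1ℤ -1ℤ 0ℤ
InM33ℤ-mod-9 1F _ _ = InM33ℤ-by-computation 1ℤ 0ℤ 0ℤ
InM33ℤ-mod-9 2F _ _ = InM33ℤ-by-computation 1ℤ 1ℤ 0ℤ
InM33ℤ-mod-9 3F _ _ = InM33ℤ-by-computation 1ℤ 1ℤ 1ℤ
InM33ℤ-mod-9 4F r≢4 _ = contradiction refl r≢4
InM33ℤ-mod-9 5F _ r≢5 = contradiction refl r≢5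
InM33ℤ-mod-9 6F _ _ = InM33ℤ-by-computation -1ℤ -1ℤ -1ℤ
InM33ℤ-mod-9 7F _ _ = InM33ℤ-by-computation -1ℤ -1ℤ 0ℤ
InM33ℤ-mod-9 8F _ _ = InM33ℤ-by-computation -1ℤ 0ℤ 0ℤ

mod-9⇒InM33ℤ : ∀ y → ¬ y % 9 ≡ 4 → ¬ y % 9 ≡ 5 → InM33ℤ 3 (+ 9) (+ y)
mod-9⇒InM33ℤ y y≢4 y≢5 = InM33ℤ-resp (≡-mod-sym (≡-mod-residue 9 (+ y)))
  (InM33ℤ-mod-9 r (λ r≡4 → y≢4 (trans (sym r≡y%9) r≡4)) (λ r≡5 → y≢5 (trans (sym r≡y%9) r≡5)))
  where
  r = residue 9 (+ y)
  r≡y%9 : toℕ r ≡ y % 9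
  r≡y%9 = toℕ-fromℕ< (ℕ.m%n<n y 9)

ThreeCubes : ℤ → ℤ → Set
ThreeCubes m z = ∃[ a ] ∃[ b ] ∃[ c ] a ³ + b ³ + c ³ ≡ z mod m

ThreeCubes⇒InM33ℤ : Prime p → ThreeCubes (+ p) z → InM33ℤ p (+ p) z
ThreeCubes⇒InM33ℤ {p} {z} pr (a , b , c , sum≡z) with + p ∣? a | + p ∣? b | + p ∣? c
... | no p∤a | _      | _      = cubes a b c p∤a sum≡z
... | yes _  | no p∤b | _      = cubes b a c p∤b (≡-mod-trans (≡⇒≡-mod swap) sum≡z)
  where
  swap : b ³ + a ³ + c ³ ≡ a ³ + b ³ + c ³
  swap = cong (_+ c ³) (ℤ.+-comm (b ³) (a ³))
... | yes _  | yes _  | no p∤c = cubes c a b p∤c (≡-mod-trans (≡⇒≡-mod rotate) sum≡z)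
  where
  rotate : c ³ + a ³ + b ³ ≡ a ³ + b ³ + c ³
  rotate = trans (ℤ.+-assoc (c ³) (a ³) (b ³)) (ℤ.+-comm (c ³) (a ³ + b ³))
... | yes p∣a | yes p∣b | yes p∣c = cubes 1ℤ -1ℤ 0ℤ (prime∤1 pr) (begin
  1ℤ ³ + -1ℤ ³ + 0ℤ ³  ≡⟨⟩
  0ℤ                    ≈⟨ ≡-mod-sym (+-cong-mod (+-cong-mod (cube≡0 p∣a) (cube≡0 p∣b)) (cube≡0 p∣c)) ⟩
  a ³ + b ³ + c ³       ≈⟨ sum≡z ⟩
  z                     ∎)
  where
  open ≡-mod-Reasoning (+ p)
  cube≡0 : + p ∣ x → x ³ ≡ 0ℤ mod + p
  cube≡0 p∣x = ³-cong-mod (∣⇒≡0-mod p∣x)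

³-sum-neg : ∀ a b c → (- a) ³ + (- b) ³ + (- c) ³ ≡ - (a ³ + b ³ + c ³)
³-sum-neg a b c = begin
  (- a) * (- a) * (- a) + (- b) * (- b) * (- b) + (- c) * (- c) * (- c)
    ≡⟨ solve (a ∷ b ∷ c ∷ []) ⟩
  - (a * a * a + b * b * b + c * c * c)
    ∎
  where open ≡-Reasoning

ThreeCubes-neg : ThreeCubes m (- z) → ThreeCubes m z
ThreeCubes-neg {m} {z} (a , b , c , sum≡-z) = - a , - b , - c , (begin
  (- a) ³ + (- b) ³ + (- c) ³   ≡⟨ ³-sum-neg a b c ⟩
  - (a ³ + b ³ + c ³)            ≈⟨ neg-cong-mod sum≡-z ⟩
  - - z                          ≡⟨ ℤ.neg-involutive z ⟩
  z                              ∎)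
  where open ≡-mod-Reasoning m

-- Hensel lifting

-- Replacing x₁ by x₁ − t·N changes x₁³ by −t·3x₁²N modulo p·M (the divisibility hypotheses);
-- since 3N = e·M and e·x₁² is a unit mod p, t can be chosen to cancel the error of the
-- representation modulo p·M.
hensel-lift : Prime p → ∀ M N e → + 3 * N ≡ e * M →
  + p ∣ N → + p * M ∣ + 3 * (N * N) → + p * M ∣ N ³ →
  (s : InM33ℤ p M y) → let a = InM33ℤ.x₁ s in ¬ + p ∣ e * (a * a) →
  InM33ℤ p (+ p * M) y
hensel-lift {p} {y} pr M N e 3N≡eM p∣N pM∣3N² pM∣N³
            (cubes a b c a-unit (∣-diff (divides q S≡qM))) ea²-unit
  with mod-inverse pr ea²-unit
... | u , u·ea²≡1 = cubes (a - t * N) b c shifted-unit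
  (∣-diff (subst (+ p * M ∣_) (sym (expansion (b ³) (c ³) S≡qM)) divisible))
  where
  t = q * u
  higher-terms = + 3 * (N * N) * (a * t * t) - N ³ * (t * t * t)

  shifted-unit : ¬ + p ∣ a - t * N
  shifted-unit p∣a-tN = a-unit (∣m+n∣n⇒∣m p∣a-tN (∣m⇒∣-m (∣n⇒∣m*n t p∣N)))

  expansion : ∀ B C → a ³ + B + C - y ≡ q * M →
              (a - t * N) ³ + B + C - y ≡ q * ((1ℤ - u * (e * (a * a))) * M) + higher-terms
  expansion B C S≡qM = begin
    (a - q * u * N) * (a - q * u * N) * (a - q * u * N) + B + C - y
      ≡⟨ solve (a ∷ q ∷ u ∷ N ∷ B ∷ C ∷ y ∷ []) ⟩
    (a * a * a + B + C - y) - q * u * (+ 3 * N) * (a * a)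
      + (+ 3 * (N * N) * (a * (q * u) * (q * u)) - N * N * N * (q * u * (q * u) * (q * u)))
      ≡⟨ cong₂ (λ S T → S - q * u * T * (a * a) + higher-terms) S≡qM 3N≡eM ⟩
    q * M - q * u * (e * M) * (a * a)
      + (+ 3 * (N * N) * (a * (q * u) * (q * u)) - N * N * N * (q * u * (q * u) * (q * u)))
      ≡⟨ solve (q ∷ M ∷ u ∷ e ∷ a ∷ N ∷ []) ⟩
    q * ((1ℤ - u * (e * (a * a))) * M)
      + (+ 3 * (N * N) * (a * (q * u) * (q * u)) - N * N * N * (q * u * (q * u) * (q * u)))
      ∎
    where open ≡-Reasoning

  divisible : + p * M ∣ q * ((1ℤ - u * (e * (a * a))) * M) + higher-terms
  divisible = ∣m∣n⇒∣m+n (∣n⇒∣m*n q (*-monoˡ-∣ M (m∣x-y (≡-mod-sym u·ea²≡1))))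
                        (∣m∣n⇒∣m-n (∣m⇒∣m*n _ pM∣3N²) (∣m⇒∣m*n _ pM∣N³))

hensel-lift-p≢3 : Prime p → ¬ p ≡ 3 → ∀ k →
  InM33ℤ p ((+ p) ℤ.^ suc k) y → InM33ℤ p ((+ p) ℤ.^ suc (suc k)) y
hensel-lift-p≢3 {p} pr p≢3 k s@(cubes a _ _ a-unit _) =
  hensel-lift pr M M (+ 3) refl p∣M pM∣3M² (∣m⇒∣m*n M pM∣M²) s
    (prime∤* pr (prime≢3⇒∤3 pr p≢3) (prime∤* pr a-unit a-unit))
  where
  M = (+ p) ℤ.^ suc k
  p∣M : + p ∣ M
  p∣M = ∣m⇒∣m*n ((+ p) ℤ.^ k) ∣-refl
  pM∣M² : + p * M ∣ M * M
  pM∣M² = *-monoˡ-∣ M p∣M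
  pM∣3M² : + p * M ∣ + 3 * (M * M)
  pM∣3M² = ∣n⇒∣m*n (+ 3) pM∣M²

-- Here N = M / 3 and e = 1; the higher terms 3N² and N³ still vanish mod 3M once 9 ∣ M.
hensel-lift-3 : ∀ k →
  InM33ℤ 3 ((+ 3) ℤ.^ suc (suc k)) y → InM33ℤ 3 ((+ 3) ℤ.^ suc (suc (suc k))) y
hensel-lift-3 k s@(cubes a _ _ a-unit _) =
  hensel-lift prime[3] (+ 3 * N) N 1ℤ (sym (ℤ.*-identityˡ (+ 3 * N))) 3∣N 9N∣3N² 9N∣N³ s
    (subst (λ a² → ¬ + 3 ∣ a²) (sym (ℤ.*-identityˡ (a * a))) (prime∤* prime[3] a-unit a-unit))
  where
  N = (+ 3) ℤ.^ suc k
  3∣N : + 3 ∣ N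
  3∣N = ∣m⇒∣m*n ((+ 3) ℤ.^ k) ∣-refl
  3N∣N² : + 3 * N ∣ N * N
  3N∣N² = *-monoˡ-∣ N 3∣N
  9N∣3N² : + 3 * (+ 3 * N) ∣ + 3 * (N * N)
  9N∣3N² = *-monoʳ-∣ (+ 3) 3N∣N²
  3N²∣N³ : + 3 * (N * N) ∣ N * N * N
  3N²∣N³ = subst (_∣ N * N * N) (ℤ.*-comm (N * N) (+ 3)) (*-monoʳ-∣ (N * N) 3∣N)
  9N∣N³ : + 3 * (+ 3 * N) ∣ N ³
  9N∣N³ = ∣-trans 9N∣3N² 3N²∣N³

lift-p≢3 : Prime p → ¬ p ≡ 3 → InM33ℤ p (+ p) y → ∀ k → InM33ℤ p ((+ p) ℤ.^ suc k) y
lift-p≢3 {p} {y} pr p≢3 s zero = subst (λ m → InM33ℤ p m y) (sym (ℤ.*-identityʳ (+ p))) s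
lift-p≢3 pr p≢3 s (suc k) = hensel-lift-p≢3 pr p≢3 k (lift-p≢3 pr p≢3 s k)

lift-3 : InM33ℤ 3 ((+ 3) ℤ.^ 2) y → ∀ k → InM33ℤ 3 ((+ 3) ℤ.^ suc (suc k)) y
lift-3 s zero    = s
lift-3 s (suc k) = hensel-lift-3 k (lift-3 s k)

-- Representations modulo a prime p ≥ 5

ryley-denominator : ℤ → ℤ
ryley-denominator z = + 9 * (z * z) + + 81 * z + + 729

-- Ryley's identity (1825).
ryley-identity : ∀ z → (z ³ - + 729) ³ + (+ 243 * z + + 729 - z ³) ³ + (+ 27 * (z * z) + + 243 * z) ³
                     ≡ z * ryley-denominator z ³
ryley-identity z = begin
  (z * z * z - + 729) * (z * z * z - + 729) * (z * z * z - + 729)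
    + (+ 243 * z + + 729 - z * z * z) * (+ 243 * z + + 729 - z * z * z) * (+ 243 * z + + 729 - z * z * z)
    + (+ 27 * (z * z) + + 243 * z) * (+ 27 * (z * z) + + 243 * z) * (+ 27 * (z * z) + + 243 * z)
    ≡⟨ solve (z ∷ []) ⟩
  z * ((+ 9 * (z * z) + + 81 * z + + 729) * (+ 9 * (z * z) + + 81 * z + + 729)
       * (+ 9 * (z * z) + + 81 * z + + 729))
    ∎
  where open ≡-Reasoning

-- 13122 = 2 · 3⁸.
ryley-denominator-combination : ∀ z →
  (z + + 9) * ryley-denominator (- z) - (z - + 9) * ryley-denominator z ≡ + 13122
ryley-denominator-combination z = begin
  (z + + 9) * (+ 9 * (- z * - z) + + 81 * - z + + 729) - (z - + 9) * (+ 9 * (z * z) + + 81 * z + + 729)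
    ≡⟨ solve (z ∷ []) ⟩
  + 13122
    ∎
  where open ≡-Reasoning

³-sum-scale : ∀ u z a b c d →
  a ³ + b ³ + c ³ ≡ z * d ³ → (u * a) ³ + (u * b) ³ + (u * c) ³ ≡ z * (u * d) ³
³-sum-scale u z a b c d eq = begin
  u * a * (u * a) * (u * a) + u * b * (u * b) * (u * b) + u * c * (u * c) * (u * c)
    ≡⟨ solve (u ∷ a ∷ b ∷ c ∷ []) ⟩
  u * u * u * (a * a * a + b * b * b + c * c * c)
    ≡⟨ cong (u * u * u *_) eq ⟩
  u * u * u * (z * (d * d * d))
    ≡⟨ solve (u ∷ z ∷ d ∷ []) ⟩
  z * (u * d * (u * d) * (u * d))
    ∎
  where open ≡-Reasoning

ryley-three-cubes : Prime p → ∀ z → ¬ + p ∣ ryley-denominator z → ThreeCubes (+ p) z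
ryley-three-cubes {p} pr z p∤D with mod-inverse pr p∤D
... | u , uD≡1 = u * A , u * B , u * C , (begin
  (u * A) ³ + (u * B) ³ + (u * C) ³   ≡⟨ ³-sum-scale u z A B C D (ryley-identity z) ⟩
  z * (u * D) ³                        ≈⟨ *-cong-mod (≡⇒≡-mod {z} refl) (³-cong-mod uD≡1) ⟩
  z * 1ℤ                               ≡⟨ ℤ.*-identityʳ z ⟩
  z                                    ∎)
  where
  A = z ³ - + 729
  B = + 243 * z + + 729 - z ³
  C = + 27 * (z * z) + + 243 * z
  D = ryley-denominator z
  open ≡-mod-Reasoning (+ p)

ryley-denominator-of-neg : Prime p → ¬ p ≡ 2 → ¬ p ≡ 3 → ∀ z →
  + p ∣ ryley-denominator z → ¬ + p ∣ ryley-denominator (- z)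
ryley-denominator-of-neg {p} pr p≢2 p≢3 z p∣D p∣D⁻ =
  [ p≢2 , p≢3 ]′ (prime∣13122 pr (subst (+ p ∣_) (ryley-denominator-combination z) p∣combination))
  where
  p∣combination : + p ∣ (z + + 9) * ryley-denominator (- z) - (z - + 9) * ryley-denominator z
  p∣combination = ∣m∣n⇒∣m-n (∣n⇒∣m*n (z + + 9) p∣D⁻) (∣n⇒∣m*n (z - + 9) p∣D)

three-cubes-mod-prime : Prime p → ¬ p ≡ 2 → ¬ p ≡ 3 → ∀ z → ThreeCubes (+ p) z
three-cubes-mod-prime {p} pr p≢2 p≢3 z with + p ∣? ryley-denominator z
... | no p∤D  = ryley-three-cubes pr z p∤D
... | yes p∣D = ThreeCubes-neg (ryley-three-cubes pr (- z) (ryley-denominator-of-neg pr p≢2 p≢3 z p∣D))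

InM33ℤ-mod-prime≢3 : Prime p → ¬ p ≡ 3 → ∀ z → InM33ℤ p (+ p) z
InM33ℤ-mod-prime≢3 {p} pr p≢3 z with p ℕ.≟ 2
... | yes refl = InM33ℤ-residues 2 InM33ℤ-mod-2 z
... | no p≢2   = ThreeCubes⇒InM33ℤ pr (three-cubes-mod-prime pr p≢2 p≢3 z)

-- From integers to Fin n, and the obstruction modulo 9

pos-^ : ∀ p k → + (p ^ k) ≡ (+ p) ℤ.^ k
pos-^ p zero    = refl
pos-^ p (suc k) = trans (ℤ.pos-* p (p ^ k)) (cong (λ n → + p * n) (pos-^ p k))

pos-cube : ∀ n → + cube n ≡ (+ n) ³
pos-cube n = trans (ℤ.pos-* (n ℕ.* n) n) (cong (_* + n) (ℤ.pos-* n n))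

pos-cube-sum : ∀ a b c → + (cube a ℕ.+ cube b ℕ.+ cube c) ≡ (+ a) ³ + (+ b) ³ + (+ c) ³
pos-cube-sum a b c = cong₂ _+_ (cong₂ _+_ (pos-cube a) (pos-cube b)) (pos-cube c)

InM33ℤ⇒InM33 : ∀ {p n} .{{_ : ℕ.NonZero n}} → Prime p → p ℕ.∣ n →
  (y : Fin n) → InM33ℤ p (+ n) (+ toℕ y) → InM33 p n y
InM33ℤ⇒InM33 {p} {n} pr p∣n y (cubes a b c a-unit sum≡y) =
  residue n a , residue n b , residue n c , prime∤⇒coprime pr p∤r₁ ,
  residue-unique (ℕ.m%n<n S n) (toℕ<n y) (≡-mod-trans (≡-mod-sym (%ℕ-≡-mod (+ S) n)) S≡y)
  where
  r₁ = toℕ (residue n a)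
  p∤r₁ : ¬ p ℕ.∣ r₁
  p∤r₁ p∣r₁ = a-unit (≡-mod-∣ (≡-mod-residue n a) (∣ᵤ⇒∣ p∣n) (∣ᵤ⇒∣ p∣r₁))
  r₂ = toℕ (residue n b)
  r₃ = toℕ (residue n c)
  S = cube r₁ ℕ.+ cube r₂ ℕ.+ cube r₃
  open ≡-mod-Reasoning (+ n)
  S≡y : + S ≡ + toℕ y mod + n
  S≡y = begin
    + S                                          ≡⟨ pos-cube-sum r₁ r₂ r₃ ⟩
    (+ r₁) ³ + (+ r₂) ³ + (+ r₃) ³
      ≈⟨ ≡-mod-sym (+-cong-mod (+-cong-mod (³-cong-mod (≡-mod-residue n a)) (³-cong-mod (≡-mod-residue n b)))
                               (³-cong-mod (≡-mod-residue n c))) ⟩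
    a ³ + b ³ + c ³                              ≈⟨ sum≡y ⟩
    + toℕ y                                      ∎

cube-sums-mod-9 : (r₁ r₂ r₃ : Fin 3) → r₁ ≡ 0F ⊎
  (let s = (cube (toℕ r₁) ℕ.+ cube (toℕ r₂) ℕ.+ cube (toℕ r₃)) % 9 in (¬ s ≡ 4) × (¬ s ≡ 5))
cube-sums-mod-9 = toWitness {a? = all? λ r₁ → all? λ r₂ → all? λ r₃ →
  let s = (cube (toℕ r₁) ℕ.+ cube (toℕ r₂) ℕ.+ cube (toℕ r₃)) % 9 in
  (r₁ Fin.≟ 0F) ⊎-dec (¬? (s ℕ.≟ 4) ×-dec ¬? (s ℕ.≟ 5))} _

InM33⇒mod-9 : ∀ {n} .{{_ : ℕ.NonZero n}} → 9 ℕ.∣ n → (y : Fin n) → InM33 3 n y →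
  (¬ toℕ y % 9 ≡ 4) × (¬ toℕ y % 9 ≡ 5)
InM33⇒mod-9 {n} 9∣n y (x₁ , x₂ , x₃ , x₁⊥3 , S%n≡y) =
  [ (λ r₁≡0 → contradiction r₁≡0 r₁≢0) , subst (λ s → (¬ s ≡ 4) × (¬ s ≡ 5)) (sym y%9≡S′%9) ]′
    (cube-sums-mod-9 r₁ r₂ r₃)
  where
  r₁ = residue 3 (+ toℕ x₁)
  r₂ = residue 3 (+ toℕ x₂)
  r₃ = residue 3 (+ toℕ x₃)
  S  = cube (toℕ x₁) ℕ.+ cube (toℕ x₂) ℕ.+ cube (toℕ x₃)
  S′ = cube (toℕ r₁) ℕ.+ cube (toℕ r₂) ℕ.+ cube (toℕ r₃)

  r₁≢0 : ¬ r₁ ≡ 0F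
  r₁≢0 r₁≡0 = contradiction (x₁⊥3 (∣⇒∣ᵤ 3∣x₁ , ℕ.∣-refl)) λ ()
    where
    3∣x₁ : + 3 ∣ + toℕ x₁
    3∣x₁ = ≡-mod-∣ (subst (λ r → + toℕ x₁ ≡ + toℕ r mod + 3) r₁≡0 (≡-mod-residue 3 (+ toℕ x₁)))
                   ∣-refl (divides 0ℤ refl)

  y≡S′ : + toℕ y ≡ + S′ mod + 9
  y≡S′ = begin
    + toℕ y                           ≡⟨ cong +_ S%n≡y ⟨
    + (S % n)                         ≈⟨ ≡-mod-weaken (∣ᵤ⇒∣ 9∣n) (≡-mod-sym (%ℕ-≡-mod (+ S) n)) ⟩
    + S                               ≡⟨ pos-cube-sum (toℕ x₁) (toℕ x₂) (toℕ x₃) ⟩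
    (+ toℕ x₁) ³ + (+ toℕ x₂) ³ + (+ toℕ x₃) ³
      ≈⟨ +-cong-mod (+-cong-mod (cube≡residue x₁) (cube≡residue x₂)) (cube≡residue x₃) ⟩
    (+ toℕ r₁) ³ + (+ toℕ r₂) ³ + (+ toℕ r₃) ³
                                      ≡⟨ pos-cube-sum (toℕ r₁) (toℕ r₂) (toℕ r₃) ⟨
    + S′                              ∎
    where
    open ≡-mod-Reasoning (+ 9)
    cube≡residue : ∀ x → (+ toℕ x) ³ ≡ (+ toℕ (residue 3 (+ toℕ x))) ³ mod + 9
    cube≡residue x = ³-cong-mod-3⇒9 (≡-mod-residue 3 (+ toℕ x))

  y%9≡S′%9 : toℕ y % 9 ≡ S′ % 9
  y%9≡S′%9 = %-≡-mod (toℕ y) S′ 9 y≡S′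

InM33-prime≢3 : Prime p → ¬ p ≡ 3 → ∀ h .{{_ : NonZero (p ^ suc h)}} (y : Fin (p ^ suc h)) →
  InM33 p (p ^ suc h) y
InM33-prime≢3 {p} pr p≢3 h y = InM33ℤ⇒InM33 pr (ℕ.m∣m*n (p ^ h)) y
  (subst (λ m → InM33ℤ p m (+ toℕ y)) (sym (pos-^ p (suc h)))
    (lift-p≢3 pr p≢3 (InM33ℤ-mod-prime≢3 pr p≢3 (+ toℕ y)) h))

InM33-3 : (y : Fin 3) → InM33 3 3 y
InM33-3 y = InM33ℤ⇒InM33 prime[3] ℕ.∣-refl y (InM33ℤ-residues 3 InM33ℤ-mod-3 (+ toℕ y))

InM33-3^h⇔mod-9 : ∀ h → 2 ≤ h → .{{_ : NonZero (3 ^ h)}} (y : Fin (3 ^ h)) →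
  InM33 3 (3 ^ h) y ⇔ ((¬ toℕ y % 9 ≡ 4) × (¬ toℕ y % 9 ≡ 5))
InM33-3^h⇔mod-9 (suc zero)    (ℕ.s≤s ()) y
InM33-3^h⇔mod-9 (suc (suc j)) _          y =
  mk⇔ (InM33⇒mod-9 (ℕ.*-monoʳ-∣ 3 (ℕ.m∣m*n {3} (3 ^ j))) y)
      λ (y≢4 , y≢5) → InM33ℤ⇒InM33 prime[3] (ℕ.m∣m*n (3 ^ suc j)) y
        (subst (λ m → InM33ℤ 3 m (+ toℕ y)) (sym (pos-^ 3 (suc (suc j))))
          (lift-3 (mod-9⇒InM33ℤ (toℕ y) y≢4 y≢5) j))

lemma4p1 : (p h : ℕ) → Prime p → 1 ≤ h → .{{_ : NonZero (p ^ h)}} →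
    ((¬ p ≡ 3) → (y : Fin (p ^ h)) → InM33 p (p ^ h) y)
    × ((p ≡ 3) → h ≡ 1 → (y : Fin (p ^ h)) → InM33 p (p ^ h) y)
    × ((p ≡ 3) → 2 ≤ h → (y : Fin (p ^ h)) →
        InM33 p (p ^ h) y ⇔ ((¬ toℕ y % 9 ≡ 4) × (¬ toℕ y % 9 ≡ 5)))
lemma4p1 p zero    pr ()
lemma4p1 p (suc h) pr _ =
  (λ p≢3 y → InM33-prime≢3 pr p≢3 h y) ,
  (λ { refl refl y → InM33-3 y }) ,
  (λ { refl 2≤h y → InM33-3^h⇔mod-9 (suc h) 2≤h y })
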